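{- For any positive integers $d$ and $m$, the greatest common divisor of the numbers $(m+1)^d - m^d,\ (m+2)^d - m^d,\ \dots,\ (m+d)^d - m^d$ is $1$. -}

module Defs where

open import Data.Nat using (ℕ; suc; _+_; _∸_; _^_)
open import Data.Nat.GCD using (gcd)
open import Data.List using (List; foldr; map; upTo)

gcdList : List ℕ → ℕ
gcdList = foldr gcd 0

-- the list [ (m+1)^d - m^d , ... , (m+d)^d - m^d ]
-- (upTo d = [0,...,d-1], so i ranges over 1..d via suc i);
-- truncated subtraction is exact here since (m+i)^d ≥ m^d
diffs : ℕ → ℕ → List ℕ
diffs d m = map (λ i → (m + suc i) ^ d ∸ m ^ d) (upTo d)

-- If g divides every (m+y)^d − m^d for y = 0, …, d, it divides the d-th finite difference of
-- y ↦ (m+y)^d at 0, which is d!. A divisor 1 < q ≤ d of g is impossible: choosing i < q with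
-- q ∣ m+i, the differences at i and i+1 give q ∣ (m+i+1)^d − (m+i)^d, while (m+i+1)^d ≡ 1 and
-- (m+i)^d ≡ 0 modulo q. So g is coprime to 1, …, d and divides d!, hence g = 1.
module Submission where

open import Defs
open import Data.Nat using (ℕ; NonZero; zero; suc; _≤_; _<_; z≤n; s≤s; _!)
open import Data.Nat.Properties using (≤-trans; <⇒≤; m≤n⇒m≤1+n; n<1+n; +-suc; +-identityʳ; m≤m+n; ^-monoˡ-≤)
import Data.Nat as ℕ
import Data.Nat.Divisibility as ℕ
open import Data.Nat.GCD using (gcd[m,n]∣m; gcd[m,n]∣n)
open import Data.Nat.Coprimality using (Coprime; coprime-divisor)
open import Data.Integer using (ℤ; +_; _+_; _-_; _*_; _^_; 1ℤ; 0ℤ)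
import Data.Integer.Properties as ℤ
open import Data.Integer.Divisibility.Signed using (_∣_; divides; ∣ᵤ⇒∣; ∣⇒∣ᵤ; ∣-refl; ∣-trans; ∣m∣n⇒∣m+n; ∣m∣n⇒∣m-n; ∣m⇒∣m*n; ∣n⇒∣m*n)
open import Data.Integer.Tactic.RingSolver using (solve-∀)
open import Data.List using (_∷_)
open import Data.List.Membership.Propositional using (_∈_)
open import Data.List.Membership.Propositional.Properties using (∈-map⁺; ∈-upTo⁺)
open import Data.List.Relation.Unary.Any using (here; there)
open import Data.Product using (∃-syntax; _×_; _,_)
open import Relation.Nullary using (contradiction)
open import Relation.Binary.PropositionalEquality using (_≡_; _≗_; refl; sym; trans; cong; cong₂; subst; module ≡-Reasoning)

Δ : (ℕ → ℤ) → ℕ → ℤ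
Δ f y = f (suc y) - f y

Δ^ : ℕ → (ℕ → ℤ) → ℕ → ℤ
Δ^ zero    f = f
Δ^ (suc n) f = Δ^ n (Δ f)

Δ^-cong : ∀ n {f g} → f ≗ g → Δ^ n f ≗ Δ^ n g
Δ^-cong zero    f≗g = f≗g
Δ^-cong (suc n) f≗g = Δ^-cong n (λ y → cong₂ _-_ (f≗g (suc y)) (f≗g y))

Δ^-+ : ∀ n f g → Δ^ n (λ y → f y + g y) ≗ λ y → Δ^ n f y + Δ^ n g y
Δ^-+ zero    f g y = refl
Δ^-+ (suc n) f g y = trans (Δ^-cong n Δ-+ y) (Δ^-+ n (Δ f) (Δ g) y)
  where
  +-minus-+ : ∀ a b c d → (a + b) - (c + d) ≡ (a - c) + (b - d)
  +-minus-+ = solve-∀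
  Δ-+ : Δ (λ y → f y + g y) ≗ λ y → Δ f y + Δ g y
  Δ-+ y = +-minus-+ (f (suc y)) (g (suc y)) (f y) (g y)

Δ^-minus-const : ∀ n f K → Δ^ (suc n) (λ y → f y - K) ≗ Δ^ (suc n) f
Δ^-minus-const n f K = Δ^-cong n (λ y → cancel (f (suc y)) (f y) K)
  where
  cancel : ∀ a b k → (a - k) - (b - k) ≡ a - b
  cancel = solve-∀

Δ^-∣ : ∀ n {k} f → (∀ y → y ≤ n → k ∣ f y) → k ∣ Δ^ n f 0
Δ^-∣ zero    f k∣f = k∣f 0 z≤n
Δ^-∣ (suc n) f k∣f = Δ^-∣ n (Δ f) (λ y y≤n → ∣m∣n⇒∣m-n (k∣f (suc y) (s≤s y≤n)) (k∣f y (m≤n⇒m≤1+n y≤n)))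

+suc : ∀ c y → c + + suc y ≡ (c + + y) + 1ℤ
+suc c y = trans (cong (λ t → c + t) (ℤ.pos-+ 1 y)) (+-comm-1 c (+ y))
  where
  +-comm-1 : ∀ a b → a + (1ℤ + b) ≡ (a + b) + 1ℤ
  +-comm-1 = solve-∀

Δ-linear-* : ∀ c f → Δ (λ y → (c + + y) * f y) ≗ λ y → ((c + 1ℤ) + + y) * Δ f y + f y
Δ-linear-* c f y = begin
  (c + + suc y) * f (suc y) - (c + + y) * f y
    ≡⟨ cong (λ t → t * f (suc y) - (c + + y) * f y) (+suc c y) ⟩
  ((c + + y) + 1ℤ) * f (suc y) - (c + + y) * f y
    ≡⟨ product-rule c (+ y) (f (suc y)) (f y) ⟩
  ((c + 1ℤ) + + y) * Δ f y + f y
    ∎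
  where
  open ≡-Reasoning
  product-rule : ∀ c y a b → ((c + y) + 1ℤ) * a - (c + y) * b ≡ ((c + 1ℤ) + y) * (a - b) + b
  product-rule = solve-∀

Δ^-linear-* : ∀ n c f a → (∀ y → Δ^ n f y ≡ a) → ∀ y → Δ^ (suc n) (λ y → (c + + y) * f y) y ≡ + suc n * a
Δ^-linear-* zero c f a f≡a y = begin
  Δ (λ y → (c + + y) * f y) y      ≡⟨ Δ-linear-* c f y ⟩
  ((c + 1ℤ) + + y) * Δ f y + f y   ≡⟨ cong₂ (λ s t → ((c + 1ℤ) + + y) * (s - t) + t) (f≡a (suc y)) (f≡a y) ⟩
  ((c + 1ℤ) + + y) * (a - a) + a   ≡⟨ const-rule ((c + 1ℤ) + + y) a ⟩
  1ℤ * a                           ∎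
  where
  open ≡-Reasoning
  const-rule : ∀ x a → x * (a - a) + a ≡ 1ℤ * a
  const-rule = solve-∀
Δ^-linear-* (suc n) c f a Δ^f≡a y = begin
  Δ^ (suc n) (Δ (λ y → (c + + y) * f y)) y                          ≡⟨ Δ^-cong (suc n) (Δ-linear-* c f) y ⟩
  Δ^ (suc n) (λ y → ((c + 1ℤ) + + y) * Δ f y + f y) y                ≡⟨ Δ^-+ (suc n) (λ y → ((c + 1ℤ) + + y) * Δ f y) f y ⟩
  Δ^ (suc n) (λ y → ((c + 1ℤ) + + y) * Δ f y) y + Δ^ (suc n) f y     ≡⟨ cong₂ _+_ (Δ^-linear-* n (c + 1ℤ) (Δ f) a Δ^f≡a y) (Δ^f≡a y) ⟩
  + suc n * a + a                                                   ≡⟨ one-more (+ suc n) a ⟩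
  (1ℤ + + suc n) * a                                                ≡⟨ cong (_* a) (ℤ.pos-+ 1 (suc n)) ⟨
  + suc (suc n) * a                                                 ∎
  where
  open ≡-Reasoning
  one-more : ∀ k a → k * a + a ≡ (1ℤ + k) * a
  one-more = solve-∀

Δ^n-pow-n : ∀ n c y → Δ^ n (λ y → (c + + y) ^ n) y ≡ + (n !)
Δ^n-pow-n zero    c y = refl
Δ^n-pow-n (suc n) c y =
  trans (Δ^-linear-* n c (λ y → (c + + y) ^ n) (+ (n !)) (Δ^n-pow-n n c) y) (sym (ℤ.pos-* (suc n) (n !)))

powDiff : ℕ → ℤ → ℕ → ℤ
powDiff d c y = (c + + y) ^ d - c ^ d

Δ^-powDiff : ∀ n c y → Δ^ (suc n) (powDiff (suc n) c) y ≡ + (suc n !)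
Δ^-powDiff n c y = trans (Δ^-minus-const n (λ y → (c + + y) ^ suc n) (c ^ suc n) y) (Δ^n-pow-n (suc n) c y)

∣[i+1]^n-1 : ∀ i n → i ∣ (i + 1ℤ) ^ n - 1ℤ
∣[i+1]^n-1 i zero    = divides 0ℤ refl
∣[i+1]^n-1 i (suc n) = subst (i ∣_) (sym (expand i ((i + 1ℤ) ^ n))) (∣m∣n⇒∣m+n (∣n⇒∣m*n (i + 1ℤ) (∣[i+1]^n-1 i n)) ∣-refl)
  where
  expand : ∀ i p → (i + 1ℤ) * p - 1ℤ ≡ (i + 1ℤ) * (p - 1ℤ) + i
  expand = solve-∀

∃[i≤n]1+n∣m+i : ∀ n m → ∃[ i ] i < suc n × suc n ℕ.∣ m ℕ.+ i
∃[i≤n]1+n∣m+i n zero    = 0 , s≤s z≤n , (suc n ℕ.∣0)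
∃[i≤n]1+n∣m+i n (suc m) with ∃[i≤n]1+n∣m+i n m
... | zero , _ , n∣m+0 =
  n , n<1+n n , subst (suc n ℕ.∣_) (trans (cong (ℕ._+ suc n) (+-identityʳ m)) (+-suc m n)) (ℕ.∣m∣n⇒∣m+n n∣m+0 ℕ.∣-refl)
... | suc i , s≤s i<n , n∣m+1+i = i , m≤n⇒m≤1+n i<n , subst (suc n ℕ.∣_) (+-suc m i) n∣m+1+i

∣powDiff⇒≡1 : ∀ d m q → 0 < q → (∀ y → y ≤ q → + q ∣ powDiff (suc d) (+ m) y) → q ≡ 1
∣powDiff⇒≡1 d m (suc q) _ q∣powDiff with ∃[i≤n]1+n∣m+i q m
... | i , i<q , q∣m+i = ℕ.∣1⇒≡1 (∣⇒∣ᵤ q∣1)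
  where
  x = + m + + i
  A = (x + 1ℤ) ^ suc d
  B = x ^ suc d
  M = (+ m) ^ suc d
  q∣x : + suc q ∣ x
  q∣x = subst (+ suc q ∣_) (ℤ.pos-+ m i) (∣ᵤ⇒∣ q∣m+i)
  q∣A-M : + suc q ∣ A - M
  q∣A-M = subst (λ t → + suc q ∣ t ^ suc d - M) (+suc (+ m) i) (q∣powDiff (suc i) i<q)
  q∣B-M : + suc q ∣ B - M
  q∣B-M = q∣powDiff i (<⇒≤ i<q)
  combine : ∀ A B M → ((A - M) - (B - M)) - (A - 1ℤ) + B ≡ 1ℤ
  combine = solve-∀
  q∣1 : + suc q ∣ 1ℤ
  q∣1 = subst (+ suc q ∣_) (combine A B M)
    (∣m∣n⇒∣m+n (∣m∣n⇒∣m-n (∣m∣n⇒∣m-n q∣A-M q∣B-M) (∣-trans q∣x (∣[i+1]^n-1 x (suc d)))) (∣m⇒∣m*n (x ^ d) q∣x))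

gcdList-∣ : ∀ {x xs} → x ∈ xs → gcdList xs ℕ.∣ x
gcdList-∣ {x} {.x ∷ xs} (here refl) = gcd[m,n]∣m x (gcdList xs)
gcdList-∣ {x} {y ∷ xs} (there x∈xs) = ℕ.∣-trans (gcd[m,n]∣n y (gcdList xs)) (gcdList-∣ x∈xs)

pos-^ : ∀ a n → + (a ℕ.^ n) ≡ (+ a) ^ n
pos-^ a zero    = refl
pos-^ a (suc n) = trans (ℤ.pos-* a (a ℕ.^ n)) (cong (+ a *_) (pos-^ a n))

pos-∸ : ∀ {a b} → b ≤ a → + (a ℕ.∸ b) ≡ + a - + b
pos-∸ {a} {b} b≤a = sym (trans (ℤ.m-n≡m⊖n a b) (ℤ.≤-⊖ b≤a))

diffs-powDiff : ∀ d m i → + ((m ℕ.+ suc i) ℕ.^ d ℕ.∸ m ℕ.^ d) ≡ powDiff d (+ m) (suc i)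
diffs-powDiff d m i = trans (pos-∸ (^-monoˡ-≤ d (m≤m+n m (suc i))))
  (cong₂ _-_ (trans (pos-^ (m ℕ.+ suc i) d) (cong (_^ d) (ℤ.pos-+ m (suc i)))) (pos-^ m d))

gcdList-diffs-∣ : ∀ d m y → y ≤ d → + gcdList (diffs d m) ∣ powDiff d (+ m) y
gcdList-diffs-∣ d m zero    _    = subst (+ gcdList (diffs d m) ∣_) (sym powDiff-0) (divides 0ℤ refl)
  where
  powDiff-0 : powDiff d (+ m) 0 ≡ 0ℤ
  powDiff-0 = trans (cong (λ t → t ^ d - (+ m) ^ d) (ℤ.+-identityʳ (+ m))) (ℤ.+-inverseʳ ((+ m) ^ d))
gcdList-diffs-∣ d m (suc i) i<d = subst (+ gcdList (diffs d m) ∣_) (diffs-powDiff d m i)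
  (∣ᵤ⇒∣ (gcdList-∣ (∈-map⁺ (λ i → (m ℕ.+ suc i) ℕ.^ d ℕ.∸ m ℕ.^ d) (∈-upTo⁺ i<d))))

∣n!⇒≡1 : ∀ n g → (∀ {q} → 0 < q → q ≤ n → q ℕ.∣ g → q ≡ 1) → g ℕ.∣ n ! → g ≡ 1
∣n!⇒≡1 zero    g _     g∣1    = ℕ.∣1⇒≡1 g∣1
∣n!⇒≡1 (suc n) g small g∣n+1! =
  ∣n!⇒≡1 n g (λ 0<q q≤n → small 0<q (m≤n⇒m≤1+n q≤n)) (coprime-divisor coprime g∣n+1!)
  where
  coprime : Coprime g (suc n)
  coprime {zero}  (_   , 0∣n+1) = contradiction (ℕ.0∣⇒≡0 0∣n+1) λ ()
  coprime {suc q} (q∣g , q∣n+1) = small (s≤s z≤n) (ℕ.∣⇒≤ q∣n+1) q∣g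

corollary1 : (d m : ℕ) → NonZero d → NonZero m → gcdList (diffs d m) ≡ 1
corollary1 (suc d) m _ _ = ∣n!⇒≡1 (suc d) g small g∣d!
  where
  g = gcdList (diffs (suc d) m)
  g∣d! : g ℕ.∣ suc d !
  g∣d! = ∣⇒∣ᵤ (subst (+ g ∣_) (Δ^-powDiff d (+ m) 0) (Δ^-∣ (suc d) _ (gcdList-diffs-∣ (suc d) m)))
  small : ∀ {q} → 0 < q → q ≤ suc d → q ℕ.∣ g → q ≡ 1
  small 0<q q≤d q∣g = ∣powDiff⇒≡1 d m _ 0<q
    (λ y y≤q → ∣-trans (∣ᵤ⇒∣ q∣g) (gcdList-diffs-∣ (suc d) m y (≤-trans y≤q q≤d)))
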